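{- Let $T$ be a finite tree. If $c$ is a difference-1 colouring of $T$, then $c$ is the unique ASBG-colouring of $T$.
   Context: A colouring of a graph is a map from its edges to $\{\text{blue},\text{red}\}$; it is a difference-1 colouring if at every vertex the number of incident blue edges minus the number of incident red edges equals $1$. An ASBG is a bipartite graph with no isolated vertices and edges coloured blue and red, for which there is a linear ordering of the vertices such that for every vertex $u$ with neighbours listed in this order as $v_1,\dots,v_k$, the edges $uv_1,\dots,uv_k$ alternate in colour, starting and ending with blue. An ASBG-colouring of $T$ is a colouring making $T$ an ASBG. -}

module Defs where

open import Data.Nat using (ℕ; _≤_; _+_)
open import Data.Fin using (Fin)
open import Data.Bool using (Bool; true; false; T; _∧_; not)
open import Data.List using (List; []; _∷_; _++_; [_]; length; filter; map; allFin)
open import Data.List.Relation.Unary.Unique.Propositional using (Unique)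
open import Data.List.Relation.Unary.Linked using (Linked)
open import Data.List.Relation.Binary.Permutation.Propositional using (_↭_)
open import Data.Product using (Σ; ∃; _×_; _,_)
open import Relation.Binary.PropositionalEquality using (_≡_; _≢_)
open import Relation.Nullary using (¬_)
open import Relation.Nullary.Decidable using (Dec; yes; no)

record Graph (n : ℕ) : Set where
  field
    adj   : Fin n → Fin n → Bool
    sym   : ∀ u v → adj u v ≡ adj v u
    irrefl : ∀ u → adj u u ≡ false
open Graph public

module _ {n : ℕ} (G : Graph n) where

  Adj : Fin n → Fin n → Set
  Adj u v = T (adj G u v)

  data Walk : Fin n → Fin n → Set where
    here : ∀ {u} → Walk u u
    step : ∀ {u v w} → Adj u v → Walk v w → Walk u w

  Connected : Set
  Connected = ∀ u v → Walk u v

  record Cycle : Set where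
    field
      x  : Fin n
      ys : List (Fin n)
      y  : Fin n
      long     : 1 ≤ length ys
      distinct : Unique (x ∷ ys ++ [ y ])
      path     : Linked Adj (x ∷ ys ++ [ y ])
      closing  : Adj y x

  Acyclic : Set
  Acyclic = ¬ Cycle

  IsTree : Set
  IsTree = 1 ≤ n × Connected × Acyclic

  IsBipartite : Set
  IsBipartite = Σ (Fin n → Bool) λ side → ∀ u v → Adj u v → side u ≢ side v

  NoIsolated : Set
  NoIsolated = ∀ u → Σ (Fin n) λ v → Adj u v

data Colour : Set where
  blue red : Colour

isBlue : Colour → Bool
isBlue blue = true
isBlue red  = false

module _ {n : ℕ} (G : Graph n) where

  -- A colouring of the edges of G.  Represented as a function on ordered
  -- pairs of vertices that is symmetric on edges; values on non-edges are
  -- irrelevant (see IsColouring and SameColouring).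
  Colouring : Set
  Colouring = Fin n → Fin n → Colour

  IsColouring : Colouring → Set
  IsColouring c = ∀ u v → Adj G u v → c u v ≡ c v u

  SameColouring : Colouring → Colouring → Set
  SameColouring c c' = ∀ u v → Adj G u v → c u v ≡ c' u v

  blueDeg : Colouring → Fin n → ℕ
  blueDeg c u = length (filter (λ v → T? (adj G u v ∧ isBlue (c u v))) (allFin n))
    where
      T? : (b : Bool) → Dec (T b)
      T? true  = yes _
      T? false = no (λ ())

  redDeg : Colouring → Fin n → ℕ
  redDeg c u = length (filter (λ v → T? (adj G u v ∧ not (isBlue (c u v)))) (allFin n))
    where
      T? : (b : Bool) → Dec (T b)
      T? true  = yes _
      T? false = no (λ ())

  IsDiff1 : Colouring → Set
  IsDiff1 c = ∀ u → blueDeg c u ≡ redDeg c u + 1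

data Alternating : List Colour → Set where
  single : Alternating (blue ∷ [])
  more   : ∀ {xs} → Alternating xs → Alternating (blue ∷ red ∷ xs)

module _ {n : ℕ} (G : Graph n) where

  neighboursIn : List (Fin n) → Fin n → List (Fin n)
  neighboursIn ord u = filter (λ v → T? (adj G u v)) ord
    where
      T? : (b : Bool) → Dec (T b)
      T? true  = yes _
      T? false = no (λ ())

  -- A linear ordering of the vertices is a listing of all vertices,
  -- each exactly once (a permutation of allFin n).
  IsAlternatingOrder : Colouring G → List (Fin n) → Set
  IsAlternatingOrder c ord =
    ∀ u → Alternating (map (c u) (neighboursIn ord u))

  IsASBGColouring : Colouring G → Set
  IsASBGColouring c =
    IsColouring G c × IsBipartite G × NoIsolated G ×
    Σ (List (Fin n)) λ ord → (ord ↭ allFin n) × IsAlternatingOrder c ord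

module Submission where

-- A difference-1 colouring is forced. If two of them differ on an edge xy, then at y the
-- blue and red degrees of both can only balance if the two colourings also differ on another
-- edge at y; following such edges gives a non-backtracking walk that never ends, which is
-- impossible in a finite acyclic graph. Every ASBG-colouring has difference 1, because an
-- alternating sequence starting and ending with blue has one more blue than red.
--
-- For existence, list the neighbours of each vertex alternately blue, red, ..., blue, which the
-- excess of one blue edge permits. In a forest, any family of orders of the neighbourhoods is
-- induced by a single order of all vertices: remove a leaf w with neighbour v, order the rest,
-- and put w right before the first remaining neighbour of v that follows w in the order at v.
-- The same leaf induction shows that forests are bipartite.

open import Defs hiding (sym)
open import Data.Bool using (Bool; true; false; T; not; _∧_; if_then_else_)
open import Data.Bool.Properties using (T-∧; ∧-zeroʳ; not-¬)
open import Data.Empty using (⊥; ⊥-elim)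
open import Data.Fin using (Fin; _≟_)
open import Data.Fin.Properties using (any?; all?)
open import Data.List using (List; []; _∷_; _++_; [_]; length; filter; map; allFin)
open import Data.List.Properties
  using (filter-accept; filter-reject; filter-none; filter-all; filter-++; filter-≐; ++-assoc)
open import Data.List.Membership.Propositional using (_∈_; _∉_)
open import Data.List.Membership.Propositional.Properties
  using (∈-∃++; ∈-allFin; ∈-filter⁺; ∈-filter⁻; ∈-++⁺ˡ; ∈-++⁺ʳ; ∈-++⁻)
import Data.List.Membership.DecPropositional as DecMembership
open import Data.List.Relation.Binary.Disjoint.Propositional using (Disjoint)
open import Data.List.Relation.Binary.Permutation.Propositional
  using (_↭_; ↭-refl; ↭-reflexive; ↭-sym; ↭-trans; prep; swap; ↭⇒↭ₛ
        ; module PermutationReasoning)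
open import Data.List.Relation.Binary.Permutation.Propositional.Properties
  using (++-comm; ↭-length; ∈-resp-↭; filter-↭)
open import Data.List.Relation.Binary.Permutation.Setoid.Properties using (Unique-resp-↭)
open import Data.List.Relation.Unary.All as All using (All; []; _∷_)
import Data.List.Relation.Unary.All.Properties as AllP
open import Data.List.Relation.Unary.AllPairs as AllPairs using (AllPairs; []; _∷_)
open import Data.List.Relation.Unary.Any using (here; there)
open import Data.List.Relation.Unary.Linked using (Linked; []; [-]; _∷_)
open import Data.List.Relation.Unary.Unique.Propositional using (Unique)
import Data.List.Relation.Unary.Unique.Propositional.Properties as Unique
open import Data.Nat using (ℕ; suc; _+_; _<_; z≤n; s≤s)
open import Data.Nat.Induction using (<-wellFounded)
open import Data.Nat.Properties using (suc-injective; ≤-reflexive; +-comm; m≢1+n+m)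
open import Data.Product using (Σ; ∃; ∃-syntax; ∃₂; _×_; _,_; proj₁; proj₂)
open import Data.Sum using ([_,_]′)
open import Data.Unit using (tt)
open import Function using (_∘_; _on_; id)
open import Function.Bundles using (_⇔_; mk⇔; Equivalence)
open import Induction.WellFounded using (Acc; acc)
import Relation.Binary.Construct.On as On
open import Relation.Binary.Definitions using (DecidableEquality)
open import Relation.Binary.PropositionalEquality
  using (_≡_; _≢_; refl; sym; trans; cong; cong₂; subst; ≢-sym; setoid; module ≡-Reasoning)
open import Relation.Nullary using (¬_; Dec; yes; no; does; contradiction)
open import Relation.Nullary.Decidable
  using (T?; ¬?; _×-dec_; _→-dec_; dec-true; dec-false; decidable-stable)
open import Relation.Unary using (Pred; Decidable; ∁)

open Equivalence using (to; from)

T-cong⇔ : ∀ {b c} → b ≡ c → T b ⇔ T c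
T-cong⇔ refl = mk⇔ id id

module _ {a} {A : Set a} where

  interleave : List A → List A → List A
  interleave []       ys = ys
  interleave (x ∷ xs) ys = x ∷ interleave ys xs

  interleave-↭ : ∀ xs ys → interleave xs ys ↭ xs ++ ys
  interleave-↭ []       ys = ↭-refl
  interleave-↭ (x ∷ xs) ys = prep x (↭-trans (interleave-↭ ys xs) (++-comm ys xs))

  AllPairs-++⁻ : ∀ {r} {R : A → A → Set r} xs {ys} → AllPairs R (xs ++ ys) →
                 AllPairs R xs × AllPairs R ys × All (λ x → All (R x) ys) xs
  AllPairs-++⁻ []       rys          = [] , rys , []
  AllPairs-++⁻ (x ∷ xs) (rx ∷ rxys) with AllPairs-++⁻ xs rxys
  ... | rxs , rys , rxsys = AllP.++⁻ˡ xs rx ∷ rxs , rys , AllP.++⁻ʳ xs rx ∷ rxsys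

  Linked-++⁻ˡ : ∀ {r} {R : A → A → Set r} xs {ys} → Linked R (xs ++ ys) → Linked R xs
  Linked-++⁻ˡ []           _       = []
  Linked-++⁻ˡ (x ∷ [])     _       = [-]
  Linked-++⁻ˡ (x ∷ y ∷ xs) (r ∷ l) = r ∷ Linked-++⁻ˡ (y ∷ xs) l

  filter-∧ : (f g : A → Bool) (xs : List A) →
             filter (T? ∘ λ x → f x ∧ g x) xs ≡ filter (T? ∘ g) (filter (T? ∘ f) xs)
  filter-∧ f g []       = refl
  filter-∧ f g (x ∷ xs) with f x
  ... | false = filter-∧ f g xs
  ... | true with g x
  ...   | false = filter-∧ f g xs
  ...   | true  = cong (x ∷_) (filter-∧ f g xs)

module _ {a p q} {A : Set a} {P : Pred A p} {Q : Pred A q}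
         (P? : Decidable P) (Q? : Decidable Q) where

  filter-cong-∈ : ∀ xs → (∀ {x} → x ∈ xs → P x ⇔ Q x) → filter P? xs ≡ filter Q? xs
  filter-cong-∈ []       P⇔Q = refl
  filter-cong-∈ (x ∷ xs) P⇔Q with P? x
  ... | yes px = trans (cong (x ∷_) (filter-cong-∈ xs (P⇔Q ∘ there)))
                       (sym (filter-accept Q? (to (P⇔Q (here refl)) px)))
  ... | no ¬px = trans (filter-cong-∈ xs (P⇔Q ∘ there))
                       (sym (filter-reject Q? (¬px ∘ from (P⇔Q (here refl)))))

  filter-↭-except : ∀ {w xs} → Unique xs → w ∈ xs → P w → ¬ Q w →
                    (∀ {x} → x ≢ w → P x ⇔ Q x) → filter P? xs ↭ w ∷ filter Q? xs
  filter-↭-except {w} {w ∷ xs} (w∉xs ∷ _) (here refl) pw ¬qw P⇔Q = begin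
    filter P? (w ∷ xs)  ≡⟨ filter-accept P? pw ⟩
    w ∷ filter P? xs    ≡⟨ cong (w ∷_) (filter-cong-∈ xs (P⇔Q ∘ ≢-sym ∘ All.lookup w∉xs)) ⟩
    w ∷ filter Q? xs    ≡⟨ cong (w ∷_) (filter-reject Q? ¬qw) ⟨
    w ∷ filter Q? (w ∷ xs) ∎
    where open PermutationReasoning
  filter-↭-except {w} {x ∷ xs} (x∉xs ∷ u) (there w∈) pw ¬qw P⇔Q = by-cases (P? x)
    where
      open PermutationReasoning
      P⇔Q-x : P x ⇔ Q x
      P⇔Q-x = P⇔Q (All.lookup x∉xs w∈)
      by-cases : Dec (P x) → filter P? (x ∷ xs) ↭ w ∷ filter Q? (x ∷ xs)
      by-cases (yes px) = begin
          filter P? (x ∷ xs)          ≡⟨ filter-accept P? px ⟩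
          x ∷ filter P? xs            <⟨ filter-↭-except u w∈ pw ¬qw P⇔Q ⟩
          x ∷ w ∷ filter Q? xs        <<⟨ ↭-refl ⟩
          w ∷ x ∷ filter Q? xs        ≡⟨ cong (w ∷_) (filter-accept Q? (to P⇔Q-x px)) ⟨
          w ∷ filter Q? (x ∷ xs)      ∎
      by-cases (no ¬px) = begin
          filter P? (x ∷ xs)          ≡⟨ filter-reject P? ¬px ⟩
          filter P? xs                ↭⟨ filter-↭-except u w∈ pw ¬qw P⇔Q ⟩
          w ∷ filter Q? xs            ≡⟨ cong (w ∷_) (filter-reject Q? (¬px ∘ from P⇔Q-x)) ⟨
          w ∷ filter Q? (x ∷ xs)      ∎

  length-filter-except : ∀ {w xs} → Unique xs → w ∈ xs → P w → ¬ Q w →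
                         (∀ {x} → x ≢ w → P x ⇔ Q x) →
                         length (filter P? xs) ≡ suc (length (filter Q? xs))
  length-filter-except u w∈ pw ¬qw P⇔Q = ↭-length (filter-↭-except u w∈ pw ¬qw P⇔Q)

module _ {a p} {A : Set a} {P : Pred A p} (P? : Decidable P) where

  insertBefore : A → List A → List A
  insertBefore w []       = [ w ]
  insertBefore w (x ∷ xs) with does (P? x)
  ... | true  = w ∷ x ∷ xs
  ... | false = x ∷ insertBefore w xs

  insertBefore-accept : ∀ {w x} xs → P x → insertBefore w (x ∷ xs) ≡ w ∷ x ∷ xs
  insertBefore-accept {x = x} xs px with P? x
  ... | yes _   = refl
  ... | no ¬px = contradiction px ¬px

  insertBefore-reject : ∀ {w x} xs → ¬ P x → insertBefore w (x ∷ xs) ≡ x ∷ insertBefore w xs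
  insertBefore-reject {x = x} xs ¬px with P? x
  ... | yes px = contradiction px ¬px
  ... | no _   = refl

  insertBefore-↭ : ∀ w xs → insertBefore w xs ↭ w ∷ xs
  insertBefore-↭ w []       = ↭-refl
  insertBefore-↭ w (x ∷ xs) with does (P? x)
  ... | true  = ↭-refl
  ... | false = ↭-trans (prep x (insertBefore-↭ w xs)) (swap x w ↭-refl)

  insertBefore-++ : ∀ w {xs} ys → All (∁ P) xs → insertBefore w (xs ++ ys) ≡ xs ++ insertBefore w ys
  insertBefore-++ w ys []                     = refl
  insertBefore-++ w ys (_∷_ {x} {xs} ¬px ¬pxs) =
    trans (insertBefore-reject (xs ++ ys) ¬px) (cong (x ∷_) (insertBefore-++ w ys ¬pxs))

  module _ {q} {Q : Pred A q} (Q? : Decidable Q) where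

    filter-insertBefore-reject : ∀ {w} xs → ¬ Q w → filter Q? (insertBefore w xs) ≡ filter Q? xs
    filter-insertBefore-reject []       ¬qw = filter-reject Q? ¬qw
    filter-insertBefore-reject (x ∷ xs) ¬qw with does (P? x)
    ... | true  = filter-reject Q? ¬qw
    ... | false with does (Q? x)
    ...   | true  = cong (x ∷_) (filter-insertBefore-reject xs ¬qw)
    ...   | false = filter-insertBefore-reject xs ¬qw

    filter-insertBefore-accept : ∀ {w} xs → Q w → (∀ {x} → P x → Q x) →
                                 filter Q? (insertBefore w xs) ≡ insertBefore w (filter Q? xs)
    filter-insertBefore-accept {w} []       qw P⇒Q = filter-accept Q? qw
    filter-insertBefore-accept {w} (x ∷ xs) qw P⇒Q = by-cases (P? x) (Q? x)
      where
        open ≡-Reasoning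
        by-cases : Dec (P x) → Dec (Q x) →
                   filter Q? (insertBefore w (x ∷ xs)) ≡ insertBefore w (filter Q? (x ∷ xs))
        by-cases (yes px) _ = begin
          filter Q? (insertBefore w (x ∷ xs))  ≡⟨ cong (filter Q?) (insertBefore-accept xs px) ⟩
          filter Q? (w ∷ x ∷ xs)               ≡⟨ filter-accept Q? qw ⟩
          w ∷ filter Q? (x ∷ xs)               ≡⟨ cong (w ∷_) (filter-accept Q? qx) ⟩
          w ∷ x ∷ filter Q? xs                 ≡⟨ insertBefore-accept (filter Q? xs) px ⟨
          insertBefore w (x ∷ filter Q? xs)    ≡⟨ cong (insertBefore w) (filter-accept Q? qx) ⟨
          insertBefore w (filter Q? (x ∷ xs))  ∎
          where qx = P⇒Q px
        by-cases (no ¬px) (yes qx) = begin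
          filter Q? (insertBefore w (x ∷ xs))  ≡⟨ cong (filter Q?) (insertBefore-reject xs ¬px) ⟩
          filter Q? (x ∷ insertBefore w xs)    ≡⟨ filter-accept Q? qx ⟩
          x ∷ filter Q? (insertBefore w xs)    ≡⟨ cong (x ∷_) (filter-insertBefore-accept xs qw P⇒Q) ⟩
          x ∷ insertBefore w (filter Q? xs)    ≡⟨ insertBefore-reject (filter Q? xs) ¬px ⟨
          insertBefore w (x ∷ filter Q? xs)    ≡⟨ cong (insertBefore w) (filter-accept Q? qx) ⟨
          insertBefore w (filter Q? (x ∷ xs))  ∎
        by-cases (no ¬px) (no ¬qx) = begin
          filter Q? (insertBefore w (x ∷ xs))  ≡⟨ cong (filter Q?) (insertBefore-reject xs ¬px) ⟩
          filter Q? (x ∷ insertBefore w xs)    ≡⟨ filter-reject Q? ¬qx ⟩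
          filter Q? (insertBefore w xs)        ≡⟨ filter-insertBefore-accept xs qw P⇒Q ⟩
          insertBefore w (filter Q? xs)        ≡⟨ cong (insertBefore w) (filter-reject Q? ¬qx) ⟨
          insertBefore w (filter Q? (x ∷ xs))  ∎

module _ {a} {A : Set a} (_≟_ : DecidableEquality A) where

  open DecMembership _≟_ using (_∈?_)

  insertBefore-∈-self : ∀ w ys → insertBefore (_∈? ys) w ys ≡ w ∷ ys
  insertBefore-∈-self w []       = refl
  insertBefore-∈-self w (y ∷ ys) = insertBefore-accept (_∈? (y ∷ ys)) ys (here refl)

module _ {a p} {A : Set a} {P : Pred A p} (P? : Decidable P) where

  filter-≡-singleton : ∀ {v xs} → Unique xs → v ∈ xs → P v → (∀ {x} → P x → x ≡ v) →
                       filter P? xs ≡ [ v ]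
  filter-≡-singleton {v} {v ∷ xs} (v∉xs ∷ _) (here refl) pv only =
    trans (filter-accept P? pv)
          (cong (v ∷_) (filter-none P? (All.map (λ v≢x px → v≢x (sym (only px))) v∉xs)))
  filter-≡-singleton {v} {x ∷ xs} (x∉xs ∷ u) (there v∈) pv only =
    trans (filter-reject P? (λ px → All.lookup x∉xs v∈ (only px))) (filter-≡-singleton u v∈ pv only)

_≟ᶜ_ : DecidableEquality Colour
blue ≟ᶜ blue = yes refl
blue ≟ᶜ red  = no λ ()
red  ≟ᶜ blue = no λ ()
red  ≟ᶜ red  = yes refl

module _ {a} {A : Set a} (g : A → Colour) where

  interleave-alternating : ∀ {bs rs} → All (λ x → g x ≡ blue) bs → All (λ x → g x ≡ red) rs →
                           length bs ≡ suc (length rs) → Alternating (map g (interleave bs rs))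
  interleave-alternating (gb ∷ [])        []         refl rewrite gb = single
  interleave-alternating (gb ∷ gbs)       (gr ∷ grs) eq   rewrite gb | gr =
    more (interleave-alternating gbs grs (suc-injective eq))
  interleave-alternating []               _          ()
  interleave-alternating (_ ∷ _ ∷ _)      []         ()

  alternating-blue-excess : ∀ xs → Alternating (map g xs) →
    length (filter (T? ∘ isBlue ∘ g) xs) ≡ suc (length (filter (T? ∘ not ∘ isBlue ∘ g) xs))
  alternating-blue-excess (x ∷ xs) alt with g x
  alternating-blue-excess (x ∷ []) single | blue = refl
  alternating-blue-excess (x ∷ y ∷ xs) alt | blue with g y
  alternating-blue-excess (x ∷ y ∷ xs) (more alt) | blue | red =
    cong suc (alternating-blue-excess xs alt)

module _ {n : ℕ} (G : Graph n) where

  Adj-sym : ∀ {x y} → Adj G x y → Adj G y x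
  Adj-sym {x} {y} = subst T (Graph.sym G x y)

  Adj-irrefl : ∀ {x} → ¬ Adj G x x
  Adj-irrefl {x} = subst T (Graph.irrefl G x)

  -- Non-backtracking walks in acyclic graphs

  Extendable : ∀ {s} → (Fin n → Fin n → Set s) → Set s
  Extendable S = ∀ {x y} → S x y → ∃[ z ] S y z × z ≢ x

  cycle-of-revisit : ∀ {cur prev z rest} → z ∈ rest →
                     Unique (cur ∷ prev ∷ rest) → Linked (Adj G) (cur ∷ prev ∷ rest) →
                     Adj G z cur → Cycle G
  cycle-of-revisit {cur} {prev} {z} z∈rest u l z~cur with ∈-∃++ z∈rest
  ... | pre , post , refl = record
    { x        = cur
    ; ys       = prev ∷ pre
    ; y        = z
    ; long     = s≤s z≤n
    ; distinct = proj₁ (AllPairs-++⁻ (cur ∷ prev ∷ pre ++ [ z ]) (subst Unique split u))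
    ; path     = Linked-++⁻ˡ (cur ∷ prev ∷ pre ++ [ z ]) (subst (Linked (Adj G)) split l)
    ; closing  = z~cur
    }
    where
      split : cur ∷ prev ∷ pre ++ z ∷ post ≡ (cur ∷ prev ∷ pre ++ [ z ]) ++ post
      split = cong (λ xs → cur ∷ prev ∷ xs) (sym (++-assoc pre [ z ] post))

  module _ (acyclic : Acyclic G) {s} {S : Fin n → Fin n → Set s}
           (S⇒Adj : ∀ {x y} → S x y → Adj G x y) (extend : Extendable S) where

    private
      open DecMembership (_≟_ {n}) using (_∈?_; _∉?_)

      unvisited : List (Fin n) → ℕ
      unvisited p = length (filter (_∉? p) (allFin n))

      unvisited-∷ : ∀ {z p} → z ∉ p → unvisited (z ∷ p) < unvisited p
      unvisited-∷ {z} {p} z∉p = ≤-reflexive (sym (length-filter-except (_∉? p) (_∉? (z ∷ p))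
        (Unique.allFin⁺ n) (∈-allFin z) z∉p (λ z∉ → z∉ (here refl))
        (λ x≢z → mk⇔ (λ x∉p → λ { (here x≡z) → x≢z x≡z ; (there x∈p) → x∉p x∈p })
                     (λ x∉z∷p → x∉z∷p ∘ there))))

      fresh-successor : ∀ {cur prev} rest → Unique (cur ∷ prev ∷ rest) →
                        Linked (Adj G) (cur ∷ prev ∷ rest) → S prev cur →
                        ∃[ z ] S cur z × z ∉ cur ∷ prev ∷ rest
      fresh-successor {cur} {prev} rest u l s with extend s
      ... | z , s′ , z≢prev with z ∈? cur ∷ prev ∷ rest
      ... | no z∉                      = z , s′ , z∉
      ... | yes (here z≡cur)           = ⊥-elim (Adj-irrefl (subst (Adj G cur) z≡cur (S⇒Adj s′)))
      ... | yes (there (here z≡prev))  = ⊥-elim (z≢prev z≡prev)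
      ... | yes (there (there z∈rest)) = ⊥-elim (acyclic (cycle-of-revisit z∈rest u l (Adj-sym (S⇒Adj s′))))

      walk : ∀ {cur prev} rest → Unique (cur ∷ prev ∷ rest) → Linked (Adj G) (cur ∷ prev ∷ rest) →
             S prev cur → Acc _<_ (unvisited (cur ∷ prev ∷ rest)) → ⊥
      walk {cur} {prev} rest u l s (acc rs) = continue (fresh-successor rest u l s)
        where
          continue : ∃[ z ] S cur z × z ∉ cur ∷ prev ∷ rest → ⊥
          continue (z , s′ , z∉) = walk (prev ∷ rest) (AllP.¬Any⇒All¬ _ z∉ ∷ u) (Adj-sym (S⇒Adj s′) ∷ l) s′
                                        (rs (unvisited-∷ z∉))

    acyclic⇒¬extendable : ∀ {x y} → ¬ S x y
    acyclic⇒¬extendable s = walk [] (((λ { refl → Adj-irrefl (S⇒Adj s) }) ∷ []) ∷ [] ∷ [])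
                                 (Adj-sym (S⇒Adj s) ∷ [-]) s (<-wellFounded _)

  -- Induced subgraphs and leaf induction

  -- The subgraph induced by the vertices where a is true; for a = λ _ → true, adjIn a u x
  -- reduces to adj G u x.
  adjIn : (Fin n → Bool) → Fin n → Fin n → Bool
  adjIn a u x = a u ∧ (a x ∧ adj G u x)

  without : (Fin n → Bool) → Fin n → Fin n → Bool
  without a w x = not (does (x ≟ w)) ∧ a x

  aliveList : (Fin n → Bool) → List (Fin n)
  aliveList a = filter (T? ∘ a) (allFin n)

  IsLeaf : (Fin n → Bool) → Fin n → Fin n → Set
  IsLeaf a w v = T (adjIn a w v) × (∀ x → T (adjIn a w x) → x ≡ v)

  adjIn-sym : ∀ a u x → adjIn a u x ≡ adjIn a x u
  adjIn-sym a u x with a u | a x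
  ... | true  | true  = Graph.sym G u x
  ... | true  | false = refl
  ... | false | true  = refl
  ... | false | false = refl

  T-adjIn-sym : ∀ a {u x} → T (adjIn a u x) → T (adjIn a x u)
  T-adjIn-sym a {u} {x} = subst T (adjIn-sym a u x)

  adjIn⇒Adj : ∀ a {u x} → T (adjIn a u x) → Adj G u x
  adjIn⇒Adj a {u} {x} e = proj₂ (to (T-∧ {a x}) (proj₂ (to (T-∧ {a u}) e)))

  adjIn⇒alive : ∀ a {u x} → T (adjIn a u x) → T (a u)
  adjIn⇒alive a {u} e = proj₁ (to (T-∧ {a u}) e)

  without-≢ : ∀ a {w x} → x ≢ w → without a w x ≡ a x
  without-≢ a {w} {x} x≢w = cong (λ b → not b ∧ a x) (dec-false (x ≟ w) x≢w)

  without-self : ∀ a w → without a w w ≡ false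
  without-self a w = cong (λ b → not b ∧ a w) (dec-true (w ≟ w) refl)

  adjIn-without : ∀ a {w u x} → u ≢ w → x ≢ w → adjIn (without a w) u x ≡ adjIn a u x
  adjIn-without a {u = u} {x} u≢w x≢w =
    cong₂ (λ p q → p ∧ (q ∧ adj G u x)) (without-≢ a u≢w) (without-≢ a x≢w)

  ¬adjIn-without-self : ∀ a {w u} → ¬ T (adjIn (without a w) u w)
  ¬adjIn-without-self a {w} {u} =
    subst T (trans (cong (λ q → without a w u ∧ (q ∧ adj G u w)) (without-self a w)) (∧-zeroʳ _))

  ∈-aliveList⁻ : ∀ a {x} → x ∈ aliveList a → T (a x)
  ∈-aliveList⁻ a = proj₂ ∘ ∈-filter⁻ (T? ∘ a) {xs = allFin n}

  aliveList-unique : ∀ a → Unique (aliveList a)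
  aliveList-unique a = Unique.filter⁺ (T? ∘ a) (Unique.allFin⁺ n)

  aliveList-without-↭ : ∀ a {w} → T (a w) → aliveList a ↭ w ∷ aliveList (without a w)
  aliveList-without-↭ a {w} aw = filter-↭-except (T? ∘ a) (T? ∘ without a w)
    (Unique.allFin⁺ n) (∈-allFin w) aw (subst T (without-self a w))
    (λ x≢w → T-cong⇔ (sym (without-≢ a x≢w)))

  aliveList-without : ∀ a {w} → T (a w) → length (aliveList (without a w)) < length (aliveList a)
  aliveList-without a aw = ≤-reflexive (sym (↭-length (aliveList-without-↭ a aw)))

  isLeaf? : ∀ a w v → Dec (IsLeaf a w v)
  isLeaf? a w v = T? (adjIn a w v) ×-dec all? (λ x → T? (adjIn a w x) →-dec (x ≟ v))

  leaf-exists : Acyclic G → ∀ a {x y} → T (adjIn a x y) → ∃₂ λ w v → IsLeaf a w v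
  leaf-exists acyclic a e with any? (λ w → any? (isLeaf? a w))
  ... | yes leaf  = leaf
  ... | no noLeaf = ⊥-elim (acyclic⇒¬extendable acyclic (adjIn⇒Adj a) extend e)
    where
      extend : Extendable (λ x y → T (adjIn a x y))
      extend {x} {y} e′ with any? (λ z → T? (adjIn a y z) ×-dec ¬? (z ≟ x))
      ... | yes found = found
      ... | no none   = ⊥-elim (noLeaf (y , x , T-adjIn-sym a e′ ,
                          λ z e″ → decidable-stable (z ≟ x) (λ z≢x → none (z , e″ , z≢x))))

  leaf-induction : ∀ {ℓ} → Acyclic G → (P : (Fin n → Bool) → Set ℓ) →
                   (∀ a → (∀ x y → ¬ T (adjIn a x y)) → P a) →
                   (∀ {a w v} → IsLeaf a w v → P (without a w) → P a) →
                   ∀ a → P a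
  leaf-induction acyclic P base grow a = go a (On.wellFounded (length ∘ aliveList) <-wellFounded a)
    where
      go : ∀ a → Acc (_<_ on (length ∘ aliveList)) a → P a
      go a (acc rs) with any? (λ x → any? (λ y → T? (adjIn a x y)))
      ... | no noEdge = base a λ x y e → noEdge (x , y , e)
      ... | yes (x , y , e) with leaf-exists acyclic a e
      ...   | w , v , leaf@(e-wv , _) =
        grow leaf (go (without a w) (rs (aliveList-without a (adjIn⇒alive a e-wv))))

  Bipartition : (Fin n → Bool) → Set
  Bipartition a = Σ (Fin n → Bool) λ side → ∀ x y → T (adjIn a x y) → side x ≢ side y

  leaf-≢-neighbour : ∀ a {w v} → IsLeaf a w v → v ≢ w
  leaf-≢-neighbour a {w} (e-wv , _) v≡w = Adj-irrefl (subst (Adj G w) v≡w (adjIn⇒Adj a e-wv))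

  bipartition-extend : ∀ {a w v} → IsLeaf a w v → Bipartition (without a w) → Bipartition a
  bipartition-extend {a} {w} {v} leaf@(_ , only) (side′ , proper′) = side , proper
    where
      side : Fin n → Bool
      side x = if does (x ≟ w) then not (side′ v) else side′ x

      side-≢ : ∀ {x} → x ≢ w → side x ≡ side′ x
      side-≢ {x} x≢w = cong (λ b → if b then not (side′ v) else side′ x) (dec-false (x ≟ w) x≢w)

      leaf-edge : ∀ {y} → T (adjIn a w y) → side w ≢ side y
      leaf-edge {y} e eq = not-¬ refl (sym (begin
        not (side′ v) ≡⟨ cong (λ b → if b then not (side′ v) else side′ w) (dec-true (w ≟ w) refl) ⟨
        side w        ≡⟨ eq ⟩
        side y        ≡⟨ cong side (only y e) ⟩
        side v        ≡⟨ side-≢ (leaf-≢-neighbour a leaf) ⟩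
        side′ v       ∎))
        where open ≡-Reasoning

      proper : ∀ x y → T (adjIn a x y) → side x ≢ side y
      proper x y e = by-cases x y e (x ≟ w) (y ≟ w)
        where
          by-cases : ∀ x y → T (adjIn a x y) → Dec (x ≡ w) → Dec (y ≡ w) → side x ≢ side y
          by-cases _ _ e (yes refl) _          = leaf-edge e
          by-cases _ _ e (no _)     (yes refl) = ≢-sym (leaf-edge (T-adjIn-sym a e))
          by-cases x y e (no x≢w)   (no y≢w)   eq =
            proper′ x y (subst T (sym (adjIn-without a x≢w y≢w)) e)
                        (trans (sym (side-≢ x≢w)) (trans eq (side-≢ y≢w)))

  bipartition : Acyclic G → ∀ a → Bipartition a
  bipartition acyclic = leaf-induction acyclic Bipartition
    (λ a none → (λ _ → true) , λ x y e _ → none x y e) bipartition-extend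

  -- Orders of the vertices inducing given orders of the neighbourhoods

  nbrsIn : (Fin n → Bool) → Fin n → List (Fin n) → List (Fin n)
  nbrsIn a u = filter (T? ∘ adjIn a u)

  nbrsIn-no-edges : ∀ a → (∀ x y → ¬ T (adjIn a x y)) → ∀ u xs → nbrsIn a u xs ≡ []
  nbrsIn-no-edges a none u xs = filter-none (T? ∘ adjIn a u) (All.universal (none u) xs)

  record Enumerates (u : Fin n) (xs : List (Fin n)) : Set where
    field
      unique   : Unique xs
      complete : ∀ {x} → Adj G u x → x ∈ xs
      sound    : ∀ {x} → x ∈ xs → Adj G u x

  open Enumerates

  module _ (L : Fin n → List (Fin n)) (enum : ∀ u → Enumerates u (L u)) where

    Induces : (Fin n → Bool) → List (Fin n) → Set
    Induces a ord = ord ↭ aliveList a × ∀ u → nbrsIn a u ord ≡ nbrsIn a u (L u)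

    module Reinsert {a w v} (leaf : IsLeaf a w v) {ord′} (ih : Induces (without a w) ord′) where

      open DecMembership (_≟_ {n}) using (_∈?_)

      private
        a′ : Fin n → Bool
        a′ = without a w

        e-wv : T (adjIn a w v)
        e-wv = proj₁ leaf

        e-vw : T (adjIn a v w)
        e-vw = T-adjIn-sym a e-wv

        v≢w : v ≢ w
        v≢w = leaf-≢-neighbour a leaf

        ≢w-in-ord′ : ∀ {x} → x ∈ ord′ → x ≢ w
        ≢w-in-ord′ x∈ refl = subst T (without-self a w) (∈-aliveList⁻ a′ (∈-resp-↭ (proj₁ ih) x∈))

        split : ∃₂ λ pre post → L v ≡ pre ++ [ w ] ++ post
        split = ∈-∃++ (complete (enum v) (adjIn⇒Adj a e-vw))

        pre post : List (Fin n)
        pre  = proj₁ split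
        post = proj₁ (proj₂ split)

        L-v≡ : L v ≡ pre ++ w ∷ post
        L-v≡ = proj₂ (proj₂ split)

        L-v-unique : AllPairs _≢_ pre × AllPairs _≢_ (w ∷ post) × All (λ x → All (x ≢_) (w ∷ post)) pre
        L-v-unique = AllPairs-++⁻ pre (subst Unique L-v≡ (unique (enum v)))

        w∉post : All (w ≢_) post
        w∉post = AllPairs.head (proj₁ (proj₂ L-v-unique))

        pre-≢w : All (_≢ w) pre
        pre-≢w = All.map All.head (proj₂ (proj₂ L-v-unique))

      after : List (Fin n)
      after = nbrsIn a v post

      ord : List (Fin n)
      ord = insertBefore (_∈? after) w ord′

      ord-↭ : ord ↭ aliveList a
      ord-↭ = begin
        ord                         ↭⟨ insertBefore-↭ (_∈? after) w ord′ ⟩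
        w ∷ ord′                    <⟨ proj₁ ih ⟩
        w ∷ aliveList a′            ↭⟨ aliveList-without-↭ a (adjIn⇒alive a e-wv) ⟨
        aliveList a                 ∎
        where open PermutationReasoning

      nbrs-leaf : nbrsIn a w ord ≡ nbrsIn a w (L w)
      nbrs-leaf = trans (singleton ord-unique (∈-resp-↭ (↭-sym ord-↭) v-alive))
                        (sym (singleton (unique (enum w)) (complete (enum w) (adjIn⇒Adj a e-wv))))
        where
          singleton : ∀ {xs} → Unique xs → v ∈ xs → nbrsIn a w xs ≡ [ v ]
          singleton u v∈ = filter-≡-singleton (T? ∘ adjIn a w) u v∈ e-wv (proj₂ leaf _)
          ord-unique : Unique ord
          ord-unique = Unique-resp-↭ (setoid (Fin n)) (↭⇒↭ₛ (↭-sym ord-↭)) (aliveList-unique a)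
          v-alive : v ∈ aliveList a
          v-alive = ∈-filter⁺ (T? ∘ a) (∈-allFin v) (adjIn⇒alive a e-vw)

      nbrs-other : ∀ {u} → u ≢ w → u ≢ v → nbrsIn a u ord ≡ nbrsIn a u (L u)
      nbrs-other {u} u≢w u≢v = begin
        nbrsIn a u ord          ≡⟨ filter-insertBefore-reject (_∈? after) (T? ∘ adjIn a u) ord′ ¬e-uw ⟩
        nbrsIn a u ord′         ≡⟨ same-nbrs ord′ ⟨
        nbrsIn a′ u ord′        ≡⟨ proj₂ ih u ⟩
        nbrsIn a′ u (L u)       ≡⟨ same-nbrs (L u) ⟩
        nbrsIn a u (L u)        ∎
        where
          open ≡-Reasoning
          ¬e-uw : ¬ T (adjIn a u w)
          ¬e-uw e = u≢v (proj₂ leaf u (T-adjIn-sym a e))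
          same : ∀ x → Dec (x ≡ w) → T (adjIn a′ u x) ⇔ T (adjIn a u x)
          same _ (yes refl) = mk⇔ (⊥-elim ∘ ¬adjIn-without-self a {w} {u}) (⊥-elim ∘ ¬e-uw)
          same _ (no x≢w)   = T-cong⇔ (adjIn-without a u≢w x≢w)
          same-nbrs : ∀ xs → nbrsIn a′ u xs ≡ nbrsIn a u xs
          same-nbrs xs = filter-cong-∈ (T? ∘ adjIn a′ u) (T? ∘ adjIn a u) xs (λ {x} _ → same x (x ≟ w))

      nbrs-neighbour : nbrsIn a v ord ≡ nbrsIn a v (L v)
      nbrs-neighbour = begin
        nbrsIn a v ord                  ≡⟨ filter-insertBefore-accept (_∈? after) (T? ∘ adjIn a v) ord′ e-vw
                                             (proj₂ ∘ ∈-filter⁻ (T? ∘ adjIn a v) {xs = post}) ⟩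
        insert (nbrsIn a v ord′)        ≡⟨ cong insert (filter-cong-∈ _ _ ord′ (same ∘ ≢w-in-ord′)) ⟨
        insert (nbrsIn a′ v ord′)       ≡⟨ cong insert (proj₂ ih v) ⟩
        insert (nbrsIn a′ v (L v))      ≡⟨ cong insert L-without-w ⟩
        insert (nbrsIn a v pre ++ after) ≡⟨ insertBefore-++ (_∈? after) w after pre-before ⟩
        nbrsIn a v pre ++ insert after  ≡⟨ cong (nbrsIn a v pre ++_) (insertBefore-∈-self _≟_ w after) ⟩
        nbrsIn a v pre ++ w ∷ after     ≡⟨ L-with-w ⟨
        nbrsIn a v (L v)                ∎
        where
          open ≡-Reasoning

          insert : List (Fin n) → List (Fin n)
          insert = insertBefore (_∈? after) w

          same : ∀ {x} → x ≢ w → T (adjIn a′ v x) ⇔ T (adjIn a v x)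
          same x≢w = T-cong⇔ (adjIn-without a v≢w x≢w)

          L-with-w : nbrsIn a v (L v) ≡ nbrsIn a v pre ++ w ∷ after
          L-with-w = begin
            nbrsIn a v (L v)                          ≡⟨ cong (nbrsIn a v) L-v≡ ⟩
            nbrsIn a v (pre ++ w ∷ post)              ≡⟨ filter-++ (T? ∘ adjIn a v) pre (w ∷ post) ⟩
            nbrsIn a v pre ++ nbrsIn a v (w ∷ post)   ≡⟨ cong (nbrsIn a v pre ++_)
                                                           (filter-accept (T? ∘ adjIn a v) e-vw) ⟩
            nbrsIn a v pre ++ w ∷ after               ∎

          L-without-w : nbrsIn a′ v (L v) ≡ nbrsIn a v pre ++ after
          L-without-w = begin
            nbrsIn a′ v (L v)                         ≡⟨ cong (nbrsIn a′ v) L-v≡ ⟩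
            nbrsIn a′ v (pre ++ w ∷ post)             ≡⟨ filter-++ (T? ∘ adjIn a′ v) pre (w ∷ post) ⟩
            nbrsIn a′ v pre ++ nbrsIn a′ v (w ∷ post) ≡⟨ cong (nbrsIn a′ v pre ++_)
                                                           (filter-reject (T? ∘ adjIn a′ v)
                                                              (¬adjIn-without-self a {w} {v})) ⟩
            nbrsIn a′ v pre ++ nbrsIn a′ v post       ≡⟨ cong₂ _++_
                                                           (filter-cong-∈ _ _ pre (same ∘ All.lookup pre-≢w))
                                                           (filter-cong-∈ _ _ post
                                                              (same ∘ ≢-sym ∘ All.lookup w∉post)) ⟩
            nbrsIn a v pre ++ after                   ∎

          pre-before : All (_∉ after) (nbrsIn a v pre)
          pre-before = AllP.filter⁺ (T? ∘ adjIn a v) (All.map ∉after (proj₂ (proj₂ L-v-unique)))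
            where
              ∉after : ∀ {x} → All (x ≢_) (w ∷ post) → x ∉ after
              ∉after (_ ∷ x∉post) x∈after =
                All.lookup x∉post (proj₁ (∈-filter⁻ (T? ∘ adjIn a v) x∈after)) refl

      induces : Induces a ord
      induces = ord-↭ , λ u → by-cases u (u ≟ w) (u ≟ v)
        where
          by-cases : ∀ u → Dec (u ≡ w) → Dec (u ≡ v) → nbrsIn a u ord ≡ nbrsIn a u (L u)
          by-cases _ (yes refl) _          = nbrs-leaf
          by-cases _ (no _)     (yes refl) = nbrs-neighbour
          by-cases _ (no u≢w)   (no u≢v)   = nbrs-other u≢w u≢v

    induced-order : Acyclic G → ∀ a → ∃ (Induces a)
    induced-order acyclic = leaf-induction acyclic (∃ ∘ Induces)
      (λ a none → aliveList a , ↭-refl ,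
                  λ u → trans (nbrsIn-no-edges a none u (aliveList a)) (sym (nbrsIn-no-edges a none u (L u))))
      (λ leaf (ord′ , ih) → Reinsert.ord leaf ih , Reinsert.induces leaf ih)

  colouredNbrs : Colouring G → (Colour → Bool) → Fin n → List (Fin n)
  colouredNbrs c p u = filter (T? ∘ λ x → adj G u x ∧ p (c u x)) (allFin n)

  colourDeg : Colouring G → (Colour → Bool) → Fin n → ℕ
  colourDeg c p u = length (colouredNbrs c p u)

  ∈-colouredNbrs⁺ : ∀ c p {u x} → Adj G u x → T (p (c u x)) → x ∈ colouredNbrs c p u
  ∈-colouredNbrs⁺ c p {u} {x} e px =
    ∈-filter⁺ (T? ∘ λ x → adj G u x ∧ p (c u x)) (∈-allFin x) (from T-∧ (e , px))

  ∈-colouredNbrs⁻ : ∀ c p {u x} → x ∈ colouredNbrs c p u → Adj G u x × T (p (c u x))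
  ∈-colouredNbrs⁻ c p {u} {x} x∈ =
    to (T-∧ {adj G u x}) (proj₂ (∈-filter⁻ (T? ∘ λ x → adj G u x ∧ p (c u x)) {xs = allFin n} x∈))

  blueDeg≡colourDeg : ∀ c u → blueDeg G c u ≡ colourDeg c isBlue u
  blueDeg≡colourDeg c u = cong length (filter-≐ _ _ (id , id) (allFin n))

  redDeg≡colourDeg : ∀ c u → redDeg G c u ≡ colourDeg c (not ∘ isBlue) u
  redDeg≡colourDeg c u = cong length (filter-≐ _ _ (id , id) (allFin n))

  diff1⇒blue-excess : ∀ {c} → IsDiff1 G c →
                      ∀ u → colourDeg c isBlue u ≡ suc (colourDeg c (not ∘ isBlue) u)
  diff1⇒blue-excess {c} diff1 u = begin
    colourDeg c isBlue u               ≡⟨ blueDeg≡colourDeg c u ⟨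
    blueDeg G c u                      ≡⟨ diff1 u ⟩
    redDeg G c u + 1                   ≡⟨ +-comm _ 1 ⟩
    suc (redDeg G c u)                 ≡⟨ cong suc (redDeg≡colourDeg c u) ⟩
    suc (colourDeg c (not ∘ isBlue) u) ∎
    where open ≡-Reasoning

  colourDeg-along : ∀ c {ord} → ord ↭ allFin n → ∀ p u →
                    colourDeg c p u ≡ length (filter (T? ∘ p ∘ c u) (neighboursIn G ord u))
  colourDeg-along c {ord} ord-↭ p u = begin
    colourDeg c p u                                            ≡⟨ ↭-length (filter-↭ _ ord-↭) ⟨
    length (filter (T? ∘ λ x → adj G u x ∧ p (c u x)) ord)     ≡⟨ cong length (filter-∧ (adj G u) (p ∘ c u) ord) ⟩
    length (filter (T? ∘ p ∘ c u) (filter (T? ∘ adj G u) ord)) ≡⟨ cong (length ∘ filter _) (filter-≐ _ _ (id , id) ord) ⟩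
    length (filter (T? ∘ p ∘ c u) (neighboursIn G ord u))      ∎
    where open ≡-Reasoning

  asbg⇒diff1 : ∀ {c} → IsASBGColouring G c → IsDiff1 G c
  asbg⇒diff1 {c} (_ , _ , _ , ord , ord-↭ , alternating) u = begin
    blueDeg G c u                                            ≡⟨ blueDeg≡colourDeg c u ⟩
    colourDeg c isBlue u                                     ≡⟨ colourDeg-along c ord-↭ isBlue u ⟩
    length (filter (T? ∘ isBlue ∘ c u) nbrs)                 ≡⟨ alternating-blue-excess (c u) nbrs (alternating u) ⟩
    suc (length (filter (T? ∘ not ∘ isBlue ∘ c u) nbrs))     ≡⟨ cong suc (colourDeg-along c ord-↭ (not ∘ isBlue) u) ⟨
    suc (colourDeg c (not ∘ isBlue) u)                       ≡⟨ cong suc (redDeg≡colourDeg c u) ⟨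
    suc (redDeg G c u)                                       ≡⟨ +-comm 1 _ ⟩
    redDeg G c u + 1                                         ∎
    where
      open ≡-Reasoning
      nbrs : List (Fin n)
      nbrs = neighboursIn G ord u

  module _ (c : Colouring G) where

    localOrder : Fin n → List (Fin n)
    localOrder u = interleave (colouredNbrs c isBlue u) (colouredNbrs c (not ∘ isBlue) u)

    localOrder-alternating : IsDiff1 G c → ∀ u → Alternating (map (c u) (localOrder u))
    localOrder-alternating diff1 u = interleave-alternating (c u)
      (All.tabulate (blue-of ∘ proj₂ ∘ ∈-colouredNbrs⁻ c isBlue))
      (All.tabulate (red-of ∘ proj₂ ∘ ∈-colouredNbrs⁻ c (not ∘ isBlue)))
      (diff1⇒blue-excess diff1 u)
      where
        blue-of : ∀ {κ} → T (isBlue κ) → κ ≡ blue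
        blue-of {blue} _ = refl
        red-of : ∀ {κ} → T (not (isBlue κ)) → κ ≡ red
        red-of {red} _ = refl

    localOrder-enumerates : ∀ u → Enumerates u (localOrder u)
    localOrder-enumerates u = record
      { unique   = Unique-resp-↭ (setoid (Fin n)) (↭⇒↭ₛ (↭-sym split))
                     (Unique.++⁺ (unique-nbrs isBlue) (unique-nbrs (not ∘ isBlue)) disjoint)
      ; complete = ∈-resp-↭ (↭-sym split) ∘ by-colour
      ; sound    = [ proj₁ ∘ ∈-colouredNbrs⁻ c isBlue , proj₁ ∘ ∈-colouredNbrs⁻ c (not ∘ isBlue) ]′
                   ∘ ∈-++⁻ (colouredNbrs c isBlue u) ∘ ∈-resp-↭ split
      }
      where
        unique-nbrs : ∀ p → Unique (colouredNbrs c p u)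
        unique-nbrs p = Unique.filter⁺ _ (Unique.allFin⁺ n)

        split : localOrder u ↭ colouredNbrs c isBlue u ++ colouredNbrs c (not ∘ isBlue) u
        split = interleave-↭ (colouredNbrs c isBlue u) (colouredNbrs c (not ∘ isBlue) u)

        disjoint : Disjoint (colouredNbrs c isBlue u) (colouredNbrs c (not ∘ isBlue) u)
        disjoint (x∈blue , x∈red) =
          clash (proj₂ (∈-colouredNbrs⁻ c isBlue x∈blue))
                (proj₂ (∈-colouredNbrs⁻ c (not ∘ isBlue) x∈red))
          where
            clash : ∀ {κ} → T (isBlue κ) → ¬ T (not (isBlue κ))
            clash {blue} _ ()

        by-colour : ∀ {x} → Adj G u x → x ∈ colouredNbrs c isBlue u ++ colouredNbrs c (not ∘ isBlue) u
        by-colour {x} e = place (c u x) refl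
          where
            place : ∀ κ → c u x ≡ κ → x ∈ colouredNbrs c isBlue u ++ colouredNbrs c (not ∘ isBlue) u
            place blue eq = ∈-++⁺ˡ (∈-colouredNbrs⁺ c isBlue e (subst (T ∘ isBlue) (sym eq) tt))
            place red  eq = ∈-++⁺ʳ _ (∈-colouredNbrs⁺ c (not ∘ isBlue) e
                                         (subst (T ∘ not ∘ isBlue) (sym eq) tt))

    diff1⇒asbg : Acyclic G → IsColouring G c → IsDiff1 G c → IsASBGColouring G c
    diff1⇒asbg acyclic colouring diff1 =
      colouring , bipartition acyclic everything , no-isolated , ord , ord-↭ , alternating
      where
        everything : Fin n → Bool
        everything _ = true

        induced : ∃ (Induces localOrder localOrder-enumerates everything)
        induced = induced-order localOrder localOrder-enumerates acyclic everything

        ord : List (Fin n)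
        ord = proj₁ induced

        ord-↭ : ord ↭ allFin n
        ord-↭ = ↭-trans (proj₁ (proj₂ induced)) (↭-reflexive (filter-all _ (All.universal _ (allFin n))))

        nbrs-ord : ∀ u → neighboursIn G ord u ≡ localOrder u
        nbrs-ord u = begin
          neighboursIn G ord u                ≡⟨ filter-≐ _ _ (id , id) ord ⟩
          nbrsIn everything u ord             ≡⟨ proj₂ (proj₂ induced) u ⟩
          nbrsIn everything u (localOrder u)  ≡⟨ filter-all _ (All.tabulate (sound (localOrder-enumerates u))) ⟩
          localOrder u                        ∎
          where open ≡-Reasoning

        alternating : IsAlternatingOrder G c ord
        alternating u = subst (Alternating ∘ map (c u)) (sym (nbrs-ord u)) (localOrder-alternating diff1 u)

        no-isolated : NoIsolated G
        no-isolated u with localOrder u | localOrder-alternating diff1 u | sound (localOrder-enumerates u)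
        ... | x ∷ _ | _ | sound-u = x , sound-u (here refl)

  -- Uniqueness

  colourDeg-shift : ∀ {d d′ : Colouring G} {y x} (p : Colour → Bool) → Adj G y x →
                    T (p (d y x)) → ¬ T (p (d′ y x)) →
                    (∀ {z} → z ≢ x → Adj G y z → d y z ≡ d′ y z) →
                    colourDeg d p y ≡ suc (colourDeg d′ p y)
  colourDeg-shift {d} {d′} {y} {x} p e px ¬p′x agree =
    length-filter-except (T? ∘ λ z → adj G y z ∧ p (d y z)) (T? ∘ λ z → adj G y z ∧ p (d′ y z))
      (Unique.allFin⁺ n) (∈-allFin x) (from T-∧ (e , px))
      (¬p′x ∘ proj₂ ∘ to (T-∧ {adj G y x}))
      (λ z≢x → mk⇔ (recolour (agree z≢x)) (recolour (sym ∘ agree z≢x)))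
    where
      recolour : ∀ {z κ κ′} → (Adj G y z → κ ≡ κ′) → T (adj G y z ∧ p κ) → T (adj G y z ∧ p κ′)
      recolour {z} eq t with e′ , pz ← to (T-∧ {adj G y z}) t =
        from T-∧ (e′ , subst (T ∘ p) (eq e′) pz)

  blue-red-disagreement : ∀ {c c′ : Colouring G} → IsDiff1 G c → IsDiff1 G c′ → ∀ {y x} → Adj G y x →
                          c y x ≡ blue → c′ y x ≡ red →
                          (∀ {z} → z ≢ x → Adj G y z → c y z ≡ c′ y z) → ⊥
  blue-red-disagreement {c} {c′} diff1 diff1′ {y} {x} e c-blue c′-red agree =
    m≢1+n+m red-c {1} (suc-injective (begin
      suc red-c                ≡⟨ diff1⇒blue-excess diff1 y ⟨
      colourDeg c isBlue y     ≡⟨ fewer-blue ⟩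
      suc (colourDeg c′ isBlue y) ≡⟨ cong suc (diff1⇒blue-excess diff1′ y) ⟩
      suc (suc red-c′)         ≡⟨ cong (suc ∘ suc) more-red ⟩
      suc (suc (suc red-c))    ∎))
    where
      open ≡-Reasoning
      red-c red-c′ : ℕ
      red-c  = colourDeg c (not ∘ isBlue) y
      red-c′ = colourDeg c′ (not ∘ isBlue) y

      fewer-blue : colourDeg c isBlue y ≡ suc (colourDeg c′ isBlue y)
      fewer-blue = colourDeg-shift {c} {c′} isBlue e
        (subst (T ∘ isBlue) (sym c-blue) tt) (subst (¬_ ∘ T ∘ isBlue) (sym c′-red) id) agree

      more-red : red-c′ ≡ suc red-c
      more-red = colourDeg-shift {c′} {c} (not ∘ isBlue) e
        (subst (T ∘ not ∘ isBlue) (sym c′-red) tt) (subst (¬_ ∘ T ∘ not ∘ isBlue) (sym c-blue) id)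
        (λ z≢x → sym ∘ agree z≢x)

  lone-disagreement : ∀ {c c′ : Colouring G} → IsDiff1 G c → IsDiff1 G c′ → ∀ {y x} → Adj G y x →
                      c′ y x ≢ c y x → (∀ {z} → z ≢ x → Adj G y z → c′ y z ≡ c y z) → ⊥
  lone-disagreement {c} {c′} diff1 diff1′ {y} {x} e ne agree with c y x in cyx | c′ y x in c′yx
  ... | blue | blue = ne refl
  ... | red  | red  = ne refl
  ... | blue | red  = blue-red-disagreement diff1 diff1′ e cyx c′yx (λ z≢x → sym ∘ agree z≢x)
  ... | red  | blue = blue-red-disagreement diff1′ diff1 e c′yx cyx agree

  diff1-unique : Acyclic G → ∀ {c c′} → IsColouring G c → IsColouring G c′ →
                 IsDiff1 G c → IsDiff1 G c′ → SameColouring G c′ c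
  diff1-unique acyclic {c} {c′} colouring colouring′ diff1 diff1′ u v e =
    decidable-stable (c′ u v ≟ᶜ c u v) (λ ne → acyclic⇒¬extendable acyclic proj₁ extend (e , ne))
    where
      extend : Extendable (λ x y → Adj G x y × c′ x y ≢ c x y)
      extend {x} {y} (e-xy , ne)
        with any? (λ z → (T? (adj G y z) ×-dec ¬? (c′ y z ≟ᶜ c y z)) ×-dec ¬? (z ≟ x))
      ... | yes found = found
      ... | no none   = ⊥-elim (lone-disagreement diff1 diff1′ (Adj-sym e-xy) ne-yx agree)
        where
          ne-yx : c′ y x ≢ c y x
          ne-yx eq = ne (trans (colouring′ x y e-xy) (trans eq (sym (colouring x y e-xy))))
          agree : ∀ {z} → z ≢ x → Adj G y z → c′ y z ≡ c y z
          agree {z} z≢x e-yz =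
            decidable-stable (c′ y z ≟ᶜ c y z) (λ ne′ → none (z , (e-yz , ne′) , z≢x))

mainTheorem8 : ∀ (n : ℕ) (G : Graph n) → IsTree G →
    ∀ (c : Colouring G) → IsColouring G c → IsDiff1 G c →
    IsASBGColouring G c ×
    (∀ (c' : Colouring G) → IsASBGColouring G c' → SameColouring G c' c)
mainTheorem8 n G (_ , _ , acyclic) c colouring diff1 =
  diff1⇒asbg G c acyclic colouring diff1 ,
  λ c′ asbg → diff1-unique G acyclic colouring (proj₁ asbg) diff1 (asbg⇒diff1 G asbg)
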